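{- Let $H$ be a connected graph, $G$ a finite graph, and $k$ a positive integer. Maker wins the $H$-game on $G$ in at most $k$ moves if and only if there exists an edge $e\in E(G)$ such that Maker wins the $H$-game on $G[B_G(e,3^k)]$ in at most $k$ moves.
   Context: In a Maker-Breaker game on the edge set of a graph $G$, Maker and Breaker alternately claim previously unclaimed edges of $G$, Maker first. In the $H$-game the winning sets are all $F\subseteq E(G)$ such that the edge-induced subgraph $G[F]$ (edge set $F$, vertex set the endpoints of edges of $F$) is isomorphic to $H$. Maker wins in at most $k$ moves if she has a strategy guaranteeing that, among her first $k$ claimed edges, she has claimed all edges of some winning set, whatever Breaker does. For an edge $e=uv$ of $G$ and $r\in\mathbb{N}$, $B_G(e,r)=\{ww'\in E(G)\mid \max\{dist_G(u,w),dist_G(v,w),dist_G(u,w'),dist_G(v,w')\}\le r\}$, where $dist_G$ is the shortest-path distance in $G$; $G[B_G(e,r)]$ denotes the edge-induced subgraph on this edge set. -}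

module Defs where

open import Data.Nat using (ℕ; zero; suc)
open import Data.Fin using (Fin; _≟_)
open import Data.Bool using (Bool; true; false; _∧_; _∨_)
open import Data.Bool.Properties using (∧-comm)
open import Data.List using (List; []; _∷_; allFin)
open import Data.Bool.ListAction using (any)
open import Data.List.Membership.Propositional using (_∈_)
open import Data.List.Relation.Unary.All using (All)
open import Data.Product using (Σ; _×_; _,_; ∃; proj₁; proj₂)
open import Data.Sum using (_⊎_)
open import Relation.Nullary using (¬_)
open import Relation.Nullary.Decidable using (⌊_⌋)
open import Relation.Binary.PropositionalEquality using (_≡_; refl)
open import Function.Bundles using (_⇔_)

record Graph : Set where
  field
    n      : ℕ
    adj    : Fin n → Fin n → Bool
    sym    : ∀ u v → adj u v ≡ adj v u
    irrefl : ∀ u → adj u u ≡ false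
open Graph public

-- A pair of vertices; an edge uv is represented by (u , v) (or (v , u)).
VPair : ℕ → Set
VPair n = Fin n × Fin n

IsEdge : (G : Graph) → VPair (n G) → Set
IsEdge G (u , v) = adj G u v ≡ true

reach : (G : Graph) → ℕ → Fin (n G) → Fin (n G) → Bool
reach G zero    u w = ⌊ u ≟ w ⌋
reach G (suc r) u w = reach G r u w ∨ any (λ x → reach G r u x ∧ adj G x w) (allFin (n G))

Connected : Graph → Set
Connected H = Σ (Fin (n H)) (λ _ → ∀ a b → ∃ λ r → reach H r a b ≡ true)

_∈E_ : ∀ {m} → VPair m → List (VPair m) → Set
(u , v) ∈E L = ((u , v) ∈ L) ⊎ ((v , u) ∈ L)

-- G[F] ≅ H, where F is a set of edges of G given as a list.
-- φ is a bijection from V(H) onto the set of endpoints of edges of F,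
-- preserving and reflecting adjacency.
EdgeInducedIso : (H G : Graph) → List (VPair (n G)) → Set
EdgeInducedIso H G F =
  Σ (Fin (n H) → Fin (n G)) λ φ →
    (∀ a b → φ a ≡ φ b → a ≡ b)
  × (∀ a b → (adj H a b ≡ true) ⇔ ((φ a , φ b) ∈E F))
  × (∀ u v → (u , v) ∈ F → (∃ λ a → φ a ≡ u) × (∃ λ b → φ b ≡ v))
  × (∀ a → ∃ λ v → ((φ a , v) ∈E F))

Won : (H G : Graph) → List (VPair (n G)) → Set
Won H G M = Σ (List (VPair (n G))) λ F →
  All (IsEdge G) F × All (λ e → e ∈E M) F × EdgeInducedIso H G F

Unclaimed : (G : Graph) → (M B : List (VPair (n G))) → VPair (n G) → Set
Unclaimed G M B e = IsEdge G e × ¬ (e ∈E M) × ¬ (e ∈E B)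

-- MakerToMove H G k M B : Maker, to move, with Maker's edges M and Breaker's edges B,
-- can force a winning set among her edges within k further moves of hers.
-- BreakerToMove: same, Breaker to move (if no edge is left, the game ends).
mutual
  MakerToMove : (H G : Graph) → ℕ → (M B : List (VPair (n G))) → Set
  MakerToMove H G zero    M B = Won H G M
  MakerToMove H G (suc k) M B =
    Won H G M ⊎ Σ (VPair (n G)) (λ e → Unclaimed G M B e × BreakerToMove H G k (e ∷ M) B)

  BreakerToMove : (H G : Graph) → ℕ → (M B : List (VPair (n G))) → Set
  BreakerToMove H G k M B =
    Won H G M ⊎ (Σ (VPair (n G)) (Unclaimed G M B)
                 × (∀ f → Unclaimed G M B f → MakerToMove H G k M (f ∷ B)))

MakerWinsIn : (H G : Graph) → ℕ → Set
MakerWinsIn H G k = MakerToMove H G k [] []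

-- G[B_G(e,r)] for e = uv (vertex set kept as Fin n; isolated vertices do not
-- affect the H-game, whose board is the edge set B_G(e,r)).
nearBoth : (G : Graph) → VPair (n G) → ℕ → Fin (n G) → Bool
nearBoth G (u , v) r w = reach G r u w ∧ reach G r v w

ballAdj : (G : Graph) → VPair (n G) → ℕ → Fin (n G) → Fin (n G) → Bool
ballAdj G e r w w' = adj G w w' ∧ (nearBoth G e r w ∧ nearBoth G e r w')

ballAdj-sym : ∀ G e r w w' → ballAdj G e r w w' ≡ ballAdj G e r w' w
ballAdj-sym G e r w w' with adj G w w' | adj G w' w | sym G w w'
... | x | .x | refl with nearBoth G e r w | nearBoth G e r w'
... | p | q rewrite ∧-comm p q = refl

ballAdj-irrefl : ∀ G e r w → ballAdj G e r w w ≡ false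
ballAdj-irrefl G e r w with adj G w w | irrefl G w
... | .false | refl = refl

ball : (G : Graph) → VPair (n G) → ℕ → Graph
ball G e r = record
  { n = n G ; adj = ballAdj G e r ; sym = ballAdj-sym G e r ; irrefl = ballAdj-irrefl G e r }

-- If Maker wins on a ball B_G(e, 3^k), she wins on G: she follows her ball strategy and treats a
-- Breaker move she cannot mirror in the ball as some free ball edge taken instead.
-- Conversely, suppose she wins on no such ball. Breaker groups Maker's edges into clusters, each
-- lying in the 3^k-ball around its first edge, and answers every Maker move inside the ball of the
-- cluster it joined, by a move winning the local game in which all other claimed edges count as
-- his. With j moves left the clusters stay 3^j apart, so a Maker edge is close to at most one
-- cluster and radii grow by at most 3^j + 1 per move, staying within 3^k. As H is connected, a
-- copy of H among Maker's edges would lie in a single cluster, where Breaker does not lose.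

module Submission where

open import Defs renaming (sym to adj-sym)
open import Data.Nat using (ℕ; zero; suc; _+_; _*_; _^_; _≤_; z≤n; s≤s)
open import Data.Nat.Properties
  using (≤-refl; ≤-trans; n≤1+n; m≤m+n; +-identityʳ; +-suc; +-monoʳ-≤; +-monoˡ-≤; ^-monoʳ-≤; m^n>0;
         module ≤-Reasoning)
  renaming (_≟_ to _≟ℕ_)
open import Data.Nat.Tactic.RingSolver using (solve-∀)
open import Data.Fin using (Fin; zero; suc; _≟_)
open import Data.Fin.Properties using (any?; all?)
open import Data.Bool using (Bool; true; false; _∧_; _∨_)
import Data.Bool.Properties as Bool
open import Data.Bool.ListAction using (any)
open import Data.List using (List; []; _∷_; _++_; allFin; filter; map; cartesianProduct)
open import Data.List.Properties using (≡-dec)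
open import Data.List.Membership.Propositional using (_∈_; find; lose)
open import Data.List.Membership.Propositional.Properties
  using (∈-allFin; ∈-map⁺; ∈-map⁻; ∈-filter⁺; ∈-filter⁻; ∈-++⁻; ∈-cartesianProduct⁺)
import Data.List.Membership.DecPropositional as DecMembership
open import Data.List.Relation.Binary.Subset.Propositional using (_⊆_)
open import Data.List.Relation.Binary.Subset.Propositional.Properties
  using (xs⊆x∷xs; ∷⁺ʳ; ++⁺ʳ; xs⊆xs++ys; xs⊆ys++xs)
import Data.List.Relation.Unary.Any as Any
open import Data.List.Relation.Unary.Any using (here; there)
import Data.List.Relation.Unary.Any.Properties as Anyₚ
import Data.List.Relation.Unary.All as All
import Data.Vec.Functional as Vector
open import Data.Product using (Σ; ∃; _×_; _,_; proj₁; proj₂)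
import Data.Product.Properties as Product
import Data.Sum as Sum
open import Data.Sum using (_⊎_; inj₁; inj₂; [_,_]′)
open import Data.Empty using (⊥-elim)
open import Function using (_∘_)
open import Function.Bundles using (_⇔_; mk⇔; Equivalence)
open import Relation.Nullary using (¬_; Dec; yes; no; contradiction)
import Relation.Nullary.Decidable as Dec
open import Relation.Nullary.Decidable using (_×-dec_; _⊎-dec_; _→-dec_; ¬?)
open import Relation.Binary.PropositionalEquality
  using (_≡_; _≢_; _≗_; refl; sym; trans; cong; cong₂; subst)

∧-true⁻ˡ : ∀ {a b} → a ∧ b ≡ true → a ≡ true
∧-true⁻ˡ {true} _ = refl

∧-true⁻ʳ : ∀ {a b} → a ∧ b ≡ true → b ≡ true
∧-true⁻ʳ {true} p = p

∧-true⁺ : ∀ {a b} → a ≡ true → b ≡ true → a ∧ b ≡ true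
∧-true⁺ refl refl = refl

∨-true⁻ : ∀ {a b} → a ∨ b ≡ true → a ≡ true ⊎ b ≡ true
∨-true⁻ {true}  _ = inj₁ refl
∨-true⁻ {false} p = inj₂ p

∨-true⁺ˡ : ∀ {a b} → a ≡ true → a ∨ b ≡ true
∨-true⁺ˡ refl = refl

∨-true⁺ʳ : ∀ {a b} → b ≡ true → a ∨ b ≡ true
∨-true⁺ʳ {true}  _ = refl
∨-true⁺ʳ {false} p = p

any-true⁻ : ∀ {A : Set} (p : A → Bool) xs → any p xs ≡ true → ∃ λ x → x ∈ xs × p x ≡ true
any-true⁻ p xs h with find (Anyₚ.any⁻ p xs (Equivalence.from Bool.T-≡ h))
... | x , x∈ , px = x , x∈ , Equivalence.to Bool.T-≡ px

any-true⁺ : ∀ {A : Set} (p : A → Bool) {x} xs → x ∈ xs → p x ≡ true → any p xs ≡ true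
any-true⁺ p xs x∈ px = Equivalence.to Bool.T-≡ (Anyₚ.any⁺ p (lose x∈ (Equivalence.from Bool.T-≡ px)))

module Distance (G : Graph) where

  V : Set
  V = Fin (n G)

  reach-refl : ∀ r (u : V) → reach G r u u ≡ true
  reach-refl zero    u = trans (Dec.isYes≗does (u ≟ u)) (Dec.dec-true (u ≟ u) refl)
  reach-refl (suc r) u = ∨-true⁺ˡ (reach-refl r u)

  reach-zero⁻ : ∀ {u w : V} → reach G 0 u w ≡ true → u ≡ w
  reach-zero⁻ {u} {w} h with u ≟ w
  ... | yes u≡w = u≡w

  reach-suc : ∀ r {u w : V} → reach G r u w ≡ true → reach G (suc r) u w ≡ true
  reach-suc r = ∨-true⁺ˡ

  reach-step : ∀ r {u x w : V} → reach G r u x ≡ true → adj G x w ≡ true → reach G (suc r) u w ≡ true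
  reach-step r {u} {x} {w} ux xw = ∨-true⁺ʳ {reach G r u w}
    (any-true⁺ (λ y → reach G r u y ∧ adj G y w) (allFin (n G)) (∈-allFin x) (∧-true⁺ ux xw))

  reach-suc⁻ : ∀ r {u w : V} → reach G (suc r) u w ≡ true →
    reach G r u w ≡ true ⊎ Σ V λ x → reach G r u x ≡ true × adj G x w ≡ true
  reach-suc⁻ r {u} {w} h with ∨-true⁻ {reach G r u w} h
  ... | inj₁ uw = inj₁ uw
  ... | inj₂ step with any-true⁻ (λ y → reach G r u y ∧ adj G y w) (allFin (n G)) step
  ...   | x , _ , ux∧xw = inj₂ (x , ∧-true⁻ˡ ux∧xw , ∧-true⁻ʳ {reach G r u x} ux∧xw)

  reach-mono : ∀ {r s} {u w : V} → r ≤ s → reach G r u w ≡ true → reach G s u w ≡ true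
  reach-mono {zero}  {zero}  z≤n      h = h
  reach-mono {zero}  {suc s} z≤n      h = reach-suc s (reach-mono {zero} {s} z≤n h)
  reach-mono {suc r} {suc s} (s≤s le) h with reach-suc⁻ r h
  ... | inj₁ uw           = reach-suc s (reach-mono le uw)
  ... | inj₂ (x , ux , a) = reach-step s (reach-mono le ux) a

  adj⇒reach : ∀ {u w : V} → adj G u w ≡ true → reach G 1 u w ≡ true
  adj⇒reach {u} = reach-step 0 (reach-refl 0 u)

  reach-trans : ∀ r s {u w z : V} → reach G r u w ≡ true → reach G s w z ≡ true →
    reach G (r + s) u z ≡ true
  reach-trans r zero    uw wz rewrite reach-zero⁻ wz | +-identityʳ r = uw
  reach-trans r (suc s) uw wz rewrite +-suc r s with reach-suc⁻ s wz
  ... | inj₁ wz′          = reach-suc (r + s) (reach-trans r s uw wz′)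
  ... | inj₂ (x , wx , a) = reach-step (r + s) (reach-trans r s uw wx) a

  reach-sym : ∀ r {u w : V} → reach G r u w ≡ true → reach G r w u ≡ true
  reach-sym zero h rewrite reach-zero⁻ h = reach-refl 0 _
  reach-sym (suc r) {u} {w} h with reach-suc⁻ r h
  ... | inj₁ uw           = reach-suc r (reach-sym r uw)
  ... | inj₂ (x , ux , a) = reach-trans 1 r (adj⇒reach (trans (adj-sym G w x) a)) (reach-sym r ux)

  Ends : VPair (n G) → V → Set
  Ends (p , q) w = w ≡ p ⊎ w ≡ q

  ends? : ∀ x w → Dec (Ends x w)
  ends? (p , q) w = (w ≟ p) ⊎-dec (w ≟ q)

  edge-ends⇒reach : ∀ x {p q} → IsEdge G x → Ends x p → Ends x q → reach G 1 p q ≡ true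
  edge-ends⇒reach (x₁ , x₂) a (inj₁ refl) (inj₁ refl) = reach-refl 1 x₁
  edge-ends⇒reach (x₁ , x₂) a (inj₁ refl) (inj₂ refl) = adj⇒reach a
  edge-ends⇒reach (x₁ , x₂) a (inj₂ refl) (inj₁ refl) = adj⇒reach (trans (adj-sym G x₂ x₁) a)
  edge-ends⇒reach (x₁ , x₂) a (inj₂ refl) (inj₂ refl) = reach-refl 1 x₂

  nearBoth-trans : ∀ c r s {w q} → nearBoth G c r w ≡ true → reach G s w q ≡ true →
    nearBoth G c (r + s) q ≡ true
  nearBoth-trans (u , v) r s near wq =
    ∧-true⁺ (reach-trans r s (∧-true⁻ˡ near) wq) (reach-trans r s (∧-true⁻ʳ {reach G r u _} near) wq)

  nearBoth-mono : ∀ c {r s w} → r ≤ s → nearBoth G c r w ≡ true → nearBoth G c s w ≡ true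
  nearBoth-mono (u , v) {r} r≤s near =
    ∧-true⁺ (reach-mono r≤s (∧-true⁻ˡ near)) (reach-mono r≤s (∧-true⁻ʳ {reach G r u _} near))

  ballEdge⁺ : ∀ c r x → IsEdge G x → (∀ {q} → Ends x q → nearBoth G c r q ≡ true) → IsEdge (ball G c r) x
  ballEdge⁺ c r (p , q) pq near = ∧-true⁺ pq (∧-true⁺ (near (inj₁ refl)) (near (inj₂ refl)))

  ballEdge-ends : ∀ c r y {w} → IsEdge (ball G c r) y → Ends y w → nearBoth G c r w ≡ true
  ballEdge-ends c r (p , q) edge (inj₁ refl) = ∧-true⁻ˡ (∧-true⁻ʳ {adj G p q} edge)
  ballEdge-ends c r (p , q) edge (inj₂ refl) = ∧-true⁻ʳ {nearBoth G c r p} (∧-true⁻ʳ {adj G p q} edge)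

  ballEdge-mono : ∀ c {r s} y → r ≤ s → IsEdge (ball G c r) y → IsEdge (ball G c s) y
  ballEdge-mono c {r} {s} (p , q) r≤s edge =
    ballEdge⁺ c s (p , q) (∧-true⁻ˡ edge) (nearBoth-mono c r≤s ∘ ballEdge-ends c r (p , q) edge)

  edge-ends⇒nearBoth : ∀ x {q} → IsEdge G x → Ends x q → nearBoth G x 1 q ≡ true
  edge-ends⇒nearBoth (p , p′) edge x∋q =
    ∧-true⁺ (edge-ends⇒reach (p , p′) edge (inj₁ refl) x∋q) (edge-ends⇒reach (p , p′) edge (inj₂ refl) x∋q)

module _ {m : ℕ} where

  ∈E-swap : ∀ {u v : Fin m} {L} → (u , v) ∈E L → (v , u) ∈E L
  ∈E-swap (inj₁ uv) = inj₂ uv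
  ∈E-swap (inj₂ vu) = inj₁ vu

  ∈E-⊆ : ∀ {u v : Fin m} {L L′} → L ⊆ L′ → (u , v) ∈E L → (u , v) ∈E L′
  ∈E-⊆ L⊆L′ (inj₁ uv) = inj₁ (L⊆L′ uv)
  ∈E-⊆ L⊆L′ (inj₂ vu) = inj₂ (L⊆L′ vu)

  ∈E-there : ∀ {u v : Fin m} {x L} → (u , v) ∈E L → (u , v) ∈E (x ∷ L)
  ∈E-there = ∈E-⊆ there

  ∈E-∷⁻ : ∀ {u v : Fin m} {x L} → (u , v) ∈E (x ∷ L) → (u , v) ∈E (x ∷ []) ⊎ (u , v) ∈E L
  ∈E-∷⁻ (inj₁ (here uv))  = inj₁ (inj₁ (here uv))
  ∈E-∷⁻ (inj₂ (here vu))  = inj₁ (inj₂ (here vu))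
  ∈E-∷⁻ (inj₁ (there uv)) = inj₂ (inj₁ uv)
  ∈E-∷⁻ (inj₂ (there vu)) = inj₂ (inj₂ vu)

  ∈E-++⁻ : ∀ {u v : Fin m} L {L′} → (u , v) ∈E (L ++ L′) → (u , v) ∈E L ⊎ (u , v) ∈E L′
  ∈E-++⁻ L (inj₁ uv) = [ inj₁ ∘ inj₁ , inj₂ ∘ inj₁ ]′ (∈-++⁻ L uv)
  ∈E-++⁻ L (inj₂ vu) = [ inj₁ ∘ inj₂ , inj₂ ∘ inj₂ ]′ (∈-++⁻ L vu)

  _≟ᵖ_ : (e e′ : VPair m) → Dec (e ≡ e′)
  _≟ᵖ_ = Product.≡-dec _≟_ _≟_

  _∈E?_ : ∀ (e : VPair m) L → Dec (e ∈E L)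
  (u , v) ∈E? L = DecMembership._∈?_ _≟ᵖ_ (u , v) L ⊎-dec DecMembership._∈?_ _≟ᵖ_ (v , u) L

  _⊆E_ : List (VPair m) → List (VPair m) → Set
  L ⊆E L′ = ∀ {u v} → (u , v) ∈E L → (u , v) ∈E L′

  ∷⁺-⊆E : ∀ {x L L′} → L ⊆E L′ → (x ∷ L) ⊆E (x ∷ L′)
  ∷⁺-⊆E L⊆L′ uv∈ with ∈E-∷⁻ uv∈
  ... | inj₁ uv≡x = ∈E-⊆ (λ { (here refl) → here refl }) uv≡x
  ... | inj₂ uv∈L = ∈E-there (L⊆L′ uv∈L)

∃-fun? : ∀ m {p} (P : (Fin m → Fin p) → Set) → (∀ {f g} → f ≗ g → P f → P g) →
  (∀ f → Dec (P f)) → Dec (∃ P)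
∃-fun? zero    P resp P? = Dec.map′ (λ Pf → _ , Pf) (λ { (f , Pf) → resp (λ ()) Pf }) (P? (λ ()))
∃-fun? (suc m) P resp P? =
  Dec.map′ (λ { (x , f , Pf) → x Vector.∷ f , Pf })
           (λ { (f , Pf) → f zero , Vector.tail f , resp (λ { zero → refl ; (suc i) → refl }) Pf })
           (any? λ x → ∃-fun? m (λ f → P (x Vector.∷ f))
                              (λ f≗g → resp (λ { zero → refl ; (suc i) → f≗g i }))
                              (λ f → P? (x Vector.∷ f)))

isEdge? : ∀ G x → Dec (IsEdge G x)
isEdge? G (u , v) = adj G u v Bool.≟ true

-- Winning sets as embeddings

NoIsolated : Graph → Set
NoIsolated H = ∀ a → ∃ λ b → adj H a b ≡ true

module _ (H G : Graph) where

  IsEmbedding : List (VPair (n G)) → (Fin (n H) → Fin (n G)) → Set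
  IsEmbedding M φ = (∀ a b → φ a ≡ φ b → a ≡ b)
                  × (∀ a b → adj H a b ≡ true → IsEdge G (φ a , φ b) × (φ a , φ b) ∈E M)

  Embeds : List (VPair (n G)) → Set
  Embeds M = ∃ (IsEmbedding M)

  imageEdges : (Fin (n H) → Fin (n G)) → List (VPair (n G))
  imageEdges φ = map (λ (a , b) → φ a , φ b)
    (filter (isEdge? H) (cartesianProduct (allFin (n H)) (allFin (n H))))

  ∈-imageEdges⁺ : ∀ φ a b → adj H a b ≡ true → (φ a , φ b) ∈ imageEdges φ
  ∈-imageEdges⁺ φ a b ab =
    ∈-map⁺ _ (∈-filter⁺ (isEdge? H) (∈-cartesianProduct⁺ (∈-allFin a) (∈-allFin b)) ab)

  ∈-imageEdges⁻ : ∀ φ {y} → y ∈ imageEdges φ → ∃ λ a → ∃ λ b → adj H a b ≡ true × y ≡ (φ a , φ b)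
  ∈-imageEdges⁻ φ y∈ with ∈-map⁻ _ y∈
  ... | (a , b) , ab∈ , refl =
    a , b , proj₂ (∈-filter⁻ (isEdge? H) {xs = cartesianProduct (allFin (n H)) (allFin (n H))} ab∈) , refl

  won⇒embeds : ∀ {M} → Won H G M → Embeds M × NoIsolated H
  won⇒embeds {M} (F , F⊆E , F⊆M , φ , φ-inj , φ-iso , ends , covered) = (φ , φ-inj , claimed) , noIsolated
    where
    claimed : ∀ a b → adj H a b ≡ true → IsEdge G (φ a , φ b) × (φ a , φ b) ∈E M
    claimed a b ab with Equivalence.to (φ-iso a b) ab
    ... | inj₁ ab∈ = All.lookup F⊆E ab∈ , All.lookup F⊆M ab∈
    ... | inj₂ ba∈ = trans (adj-sym G (φ a) (φ b)) (All.lookup F⊆E ba∈) , ∈E-swap (All.lookup F⊆M ba∈)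
    noIsolated : NoIsolated H
    noIsolated a with covered a
    ... | v , inj₁ av∈ with ends _ _ av∈
    ...   | _ , (b , refl) = b , Equivalence.from (φ-iso a b) (inj₁ av∈)
    noIsolated a | v , inj₂ va∈ with ends _ _ va∈
    ...   | (b , refl) , _ = b , trans (adj-sym H a b) (Equivalence.from (φ-iso b a) (inj₁ va∈))

  -- The winning set is the image of the edges of H.
  embeds⇒won : ∀ {M} → Embeds M → NoIsolated H → Won H G M
  embeds⇒won {M} (φ , φ-inj , claimed) noIsolated =
    imageEdges φ , All.tabulate (image λ a b ab → proj₁ (claimed a b ab))
                 , All.tabulate (image λ a b ab → proj₂ (claimed a b ab))
                 , φ , φ-inj , (λ a b → mk⇔ (λ ab → inj₁ (∈-imageEdges⁺ φ a b ab)) reflect) , ends , covered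
    where
    image : ∀ {Q : VPair (n G) → Set} → (∀ a b → adj H a b ≡ true → Q (φ a , φ b)) →
      ∀ {y} → y ∈ imageEdges φ → Q y
    image q y∈ with ∈-imageEdges⁻ φ y∈
    ... | a , b , ab , refl = q a b ab
    reflect : ∀ {a b} → (φ a , φ b) ∈E imageEdges φ → adj H a b ≡ true
    reflect {a} {b} (inj₁ ab∈) with ∈-imageEdges⁻ φ ab∈
    ... | a′ , b′ , a′b′ , eq with φ-inj _ _ (cong proj₁ eq) | φ-inj _ _ (cong proj₂ eq)
    ...   | refl | refl = a′b′
    reflect {a} {b} (inj₂ ba∈) with ∈-imageEdges⁻ φ ba∈
    ... | a′ , b′ , a′b′ , eq with φ-inj _ _ (cong proj₁ eq) | φ-inj _ _ (cong proj₂ eq)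
    ...   | refl | refl = trans (adj-sym H a b) a′b′
    ends : ∀ u v → (u , v) ∈ imageEdges φ → (∃ λ a → φ a ≡ u) × (∃ λ b → φ b ≡ v)
    ends u v uv∈ with ∈-imageEdges⁻ φ uv∈
    ... | a , b , _ , refl = (a , refl) , (b , refl)
    covered : ∀ a → ∃ λ v → (φ a , v) ∈E imageEdges φ
    covered a with noIsolated a
    ... | b , ab = φ b , inj₁ (∈-imageEdges⁺ φ a b ab)

  embeds? : ∀ M → Dec (Embeds M)
  embeds? M = ∃-fun? (n H) _ resp λ φ →
      all? (λ a → all? λ b → (φ a ≟ φ b) →-dec (a ≟ b))
    ×-dec all? (λ a → all? λ b → isEdge? H (a , b) →-dec
                 (isEdge? G (φ a , φ b) ×-dec ((φ a , φ b) ∈E? M)))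
    where
    resp : ∀ {φ ψ} → φ ≗ ψ → IsEmbedding M φ → IsEmbedding M ψ
    resp φ≗ψ (φ-inj , claimed) =
        (λ a b ψa≡ψb → φ-inj a b (trans (φ≗ψ a) (trans ψa≡ψb (sym (φ≗ψ b)))))
      , λ a b ab → subst (λ e → IsEdge G e × e ∈E M) (cong₂ _,_ (φ≗ψ a) (φ≗ψ b)) (claimed a b ab)

  won? : ∀ M → Dec (Won H G M)
  won? M = Dec.map′ (λ (e , i) → embeds⇒won e i) won⇒embeds
    (embeds? M ×-dec all? λ a → any? λ b → isEdge? H (a , b))

module Game (H G : Graph) where

  Pair : Set
  Pair = VPair (n G)

  ∃-pair? : (P : Pair → Set) → (∀ e → Dec (P e)) → Dec (∃ P)
  ∃-pair? P P? = Dec.map′ (λ (u , v , p) → (u , v) , p) (λ ((u , v) , p) → u , v , p)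
                          (any? λ u → any? λ v → P? (u , v))

  ∀-pair? : (P : Pair → Set) → (∀ e → Dec (P e)) → Dec (∀ e → P e)
  ∀-pair? P P? = Dec.map′ (λ p (u , v) → p u v) (λ p u v → p (u , v))
                          (all? λ u → all? λ v → P? (u , v))

  ¬∀-pair⇒∃¬ : (P : Pair → Set) → (∀ e → Dec (P e)) → ¬ (∀ e → P e) → ∃ λ e → ¬ P e
  ¬∀-pair⇒∃¬ P P? ¬∀P with ∃-pair? (λ e → ¬ P e) (λ e → ¬? (P? e))
  ... | yes ∃¬P = ∃¬P
  ... | no ¬∃¬P = ⊥-elim (¬∀P λ e → Dec.decidable-stable (P? e) λ ¬Pe → ¬∃¬P (e , ¬Pe))

  unclaimed? : ∀ M B e → Dec (Unclaimed G M B e)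
  unclaimed? M B e = isEdge? G e ×-dec (¬? (e ∈E? M) ×-dec ¬? (e ∈E? B))

  mutual
    makerToMove? : ∀ k M B → Dec (MakerToMove H G k M B)
    makerToMove? zero    M B = won? H G M
    makerToMove? (suc k) M B =
      won? H G M ⊎-dec ∃-pair? _ (λ e → unclaimed? M B e ×-dec breakerToMove? k (e ∷ M) B)

    breakerToMove? : ∀ k M B → Dec (BreakerToMove H G k M B)
    breakerToMove? k M B = won? H G M ⊎-dec
      (∃-pair? _ (unclaimed? M B) ×-dec ∀-pair? _ (λ f → unclaimed? M B f →-dec makerToMove? k M (f ∷ B)))

  won⇒makerToMove : ∀ k {M B} → Won H G M → MakerToMove H G k M B
  won⇒makerToMove zero    w = w
  won⇒makerToMove (suc k) w = inj₁ w

  unclaimed-resp-⊇ : ∀ {M B B′} e → B ⊆E B′ → Unclaimed G M B′ e → Unclaimed G M B e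
  unclaimed-resp-⊇ e B⊆B′ (edge , ∉M , ∉B′) = edge , ∉M , ∉B′ ∘ B⊆B′

  -- A Breaker move onto an edge already in B′ is matched by his alternative move g in the B′-game.
  mutual
    makerToMove-resp-⊇ : ∀ k {M B B′} → B ⊆E B′ → MakerToMove H G k M B′ → MakerToMove H G k M B
    makerToMove-resp-⊇ zero    B⊆B′ w = w
    makerToMove-resp-⊇ (suc k) B⊆B′ (inj₁ w) = inj₁ w
    makerToMove-resp-⊇ (suc k) B⊆B′ (inj₂ (e , ue , bt)) =
      inj₂ (e , unclaimed-resp-⊇ e B⊆B′ ue , breakerToMove-resp-⊇ k B⊆B′ bt)

    breakerToMove-resp-⊇ : ∀ k {M B B′} → B ⊆E B′ → BreakerToMove H G k M B′ → BreakerToMove H G k M B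
    breakerToMove-resp-⊇ k B⊆B′ (inj₁ w) = inj₁ w
    breakerToMove-resp-⊇ k {M} {B} {B′} B⊆B′ (inj₂ ((g , ug) , reply)) =
      inj₂ ((g , unclaimed-resp-⊇ g B⊆B′ ug) , reply′)
      where
      reply′ : ∀ f → Unclaimed G M B f → MakerToMove H G k M (f ∷ B)
      reply′ f uf with f ∈E? B′
      ... | no f∉B′ = makerToMove-resp-⊇ k (∷⁺-⊆E B⊆B′)
                        (reply f (proj₁ uf , proj₁ (proj₂ uf) , f∉B′))
      ... | yes f∈B′ = makerToMove-resp-⊇ k ∷-⊆E (reply g ug)
        where
        ∷-⊆E : (f ∷ B) ⊆E (g ∷ B′)
        ∷-⊆E uv∈ with ∈E-∷⁻ uv∈
        ... | inj₁ (inj₁ (here refl)) = ∈E-there f∈B′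
        ... | inj₁ (inj₂ (here refl)) = ∈E-there (∈E-swap f∈B′)
        ... | inj₂ uv∈B = ∈E-there (B⊆B′ uv∈B)

  mutual
    makerToMove-mono : ∀ {j k M B} → j ≤ k → MakerToMove H G j M B → MakerToMove H G k M B
    makerToMove-mono {zero}  {k}     z≤n      w = won⇒makerToMove k w
    makerToMove-mono {suc j} {suc k} (s≤s j≤k) (inj₁ w) = inj₁ w
    makerToMove-mono {suc j} {suc k} (s≤s j≤k) (inj₂ (e , ue , bt)) =
      inj₂ (e , ue , breakerToMove-mono j≤k bt)

    breakerToMove-mono : ∀ {j k M B} → j ≤ k → BreakerToMove H G j M B → BreakerToMove H G k M B
    breakerToMove-mono j≤k (inj₁ w) = inj₁ w
    breakerToMove-mono j≤k (inj₂ (g , reply)) = inj₂ (g , λ f uf → makerToMove-mono j≤k (reply f uf))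

  stuck⇒¬makerToMove : ∀ k {M B} → ¬ Won H G M → (∀ e → ¬ Unclaimed G M B e) → ¬ MakerToMove H G k M B
  stuck⇒¬makerToMove zero    ¬w stuck w = ¬w w
  stuck⇒¬makerToMove (suc k) ¬w stuck (inj₁ w) = ¬w w
  stuck⇒¬makerToMove (suc k) ¬w stuck (inj₂ (e , ue , _)) = stuck e ue

  ¬breakerToMove⇒reply : ∀ k {M B} → ¬ BreakerToMove H G k M B →
    ¬ Won H G M × ((∀ e → ¬ Unclaimed G M B e) ⊎ ∃ λ f → Unclaimed G M B f × ¬ MakerToMove H G k M (f ∷ B))
  ¬breakerToMove⇒reply k {M} {B} ¬bt = ¬bt ∘ inj₁ , reply
    where
    reply : (∀ e → ¬ Unclaimed G M B e) ⊎ ∃ λ f → Unclaimed G M B f × ¬ MakerToMove H G k M (f ∷ B)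
    reply with ∃-pair? _ (unclaimed? M B)
    ... | no ¬∃ = inj₁ λ e ue → ¬∃ (e , ue)
    ... | yes ∃u with ¬∀-pair⇒∃¬ _ (λ f → unclaimed? M B f →-dec makerToMove? k M (f ∷ B))
                                    (λ ∀reply → ¬bt (inj₂ (∃u , ∀reply)))
    ...   | f , ¬reply with unclaimed? M B f
    ...     | yes uf = inj₂ (f , uf , λ w → ¬reply λ _ → w)
    ...     | no ¬uf = ⊥-elim (¬reply λ uf → contradiction uf ¬uf)

module BallGame (H G : Graph) (e : VPair (n G)) (r : ℕ) where

  Ball : Graph
  Ball = ball G e r

  ballEdge⇒edge : ∀ x → IsEdge Ball x → IsEdge G x
  ballEdge⇒edge (u , v) = ∧-true⁻ˡ

  won-ball⇒won : ∀ {M} → Won H Ball M → Won H G M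
  won-ball⇒won (F , F⊆E , rest) = F , All.map (ballEdge⇒edge _) F⊆E , rest

  Shadows : List (VPair (n G)) → List (VPair (n G)) → Set
  Shadows B B′ = ∀ {u v} → IsEdge Ball (u , v) → (u , v) ∈E B → (u , v) ∈E B′

  unclaimed-ball⇒unclaimed : ∀ {M B B′} x → Shadows B B′ → Unclaimed Ball M B′ x → Unclaimed G M B x
  unclaimed-ball⇒unclaimed x sh (edge , ∉M , ∉B′) = ballEdge⇒edge x edge , ∉M , ∉B′ ∘ sh edge

  -- A Breaker move outside the ball, or on a ball edge already Breaker's in the simulation,
  -- is answered as if Breaker had taken some free ball edge g instead.
  mutual
    simulateMaker : ∀ k {M B B′} → Shadows B B′ → MakerToMove H Ball k M B′ → MakerToMove H G k M B
    simulateMaker zero    sh w = won-ball⇒won w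
    simulateMaker (suc k) sh (inj₁ w) = inj₁ (won-ball⇒won w)
    simulateMaker (suc k) sh (inj₂ (x , ux , bt)) =
      inj₂ (x , unclaimed-ball⇒unclaimed x sh ux , simulateBreaker k sh bt)

    simulateBreaker : ∀ k {M B B′} → Shadows B B′ → BreakerToMove H Ball k M B′ → BreakerToMove H G k M B
    simulateBreaker k sh (inj₁ w) = inj₁ (won-ball⇒won w)
    simulateBreaker k {M} {B} {B′} sh (inj₂ ((g , ug) , reply)) =
      inj₂ ((g , unclaimed-ball⇒unclaimed g sh ug) , reply′)
      where
      reply′ : ∀ f → Unclaimed G M B f → MakerToMove H G k M (f ∷ B)
      reply′ f uf with isEdge? Ball f ×-dec ¬? (f ∈E? B′)
      ... | yes (edge , f∉B′) = simulateMaker k sh′ (reply f (edge , proj₁ (proj₂ uf) , f∉B′))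
        where
        sh′ : Shadows (f ∷ B) (f ∷ B′)
        sh′ edge uv∈ with ∈E-∷⁻ uv∈
        ... | inj₁ uv≡f = ∈E-⊆ (λ { (here refl) → here refl }) uv≡f
        ... | inj₂ uv∈B = ∈E-there (sh edge uv∈B)
      ... | no ¬free = simulateMaker k sh′ (reply g ug)
        where
        sh′ : Shadows (f ∷ B) (g ∷ B′)
        sh′ {u} {v} edge uv∈ with ∈E-∷⁻ uv∈
        ... | inj₂ uv∈B = ∈E-there (sh edge uv∈B)
        ... | inj₁ (inj₁ (here refl)) with (u , v) ∈E? B′
        ...   | yes uv∈B′ = ∈E-there uv∈B′
        ...   | no uv∉B′ = ⊥-elim (¬free (edge , uv∉B′))
        sh′ {u} {v} edge uv∈ | inj₁ (inj₂ (here refl)) with (v , u) ∈E? B′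
        ...   | yes vu∈B′ = ∈E-there (∈E-swap vu∈B′)
        ...   | no vu∉B′ = ⊥-elim (¬free (trans (ballAdj-sym G e r v u) edge , vu∉B′))

  makerWinsIn-ball⇒makerWinsIn : ∀ k → MakerWinsIn H Ball k → MakerWinsIn H G k
  makerWinsIn-ball⇒makerWinsIn k = simulateMaker k (λ _ uv∈ → uv∈)

n≤3*n : ∀ n → n ≤ 3 * n
n≤3*n n = m≤m+n n (n + (n + 0))

1+n≤3*n : ∀ {n} → 1 ≤ n → 1 + n ≤ 3 * n
1+n≤3*n {n} 1≤n = ≤-trans (+-monoˡ-≤ n 1≤n) (+-monoʳ-≤ n (m≤m+n n (n + 0)))

m+n+1+n≤m+3*n : ∀ m {n} → 1 ≤ n → m + n + 1 + n ≤ m + 3 * n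
m+n+1+n≤m+3*n m {n} 1≤n = begin
  m + n + 1 + n   ≡⟨ regroup m n ⟩
  m + n + (1 + n) ≤⟨ +-monoʳ-≤ (m + n) (+-monoˡ-≤ n 1≤n) ⟩
  m + n + (n + n) ≡⟨ triple m n ⟩
  m + 3 * n       ∎
  where
  open ≤-Reasoning
  regroup : ∀ m n → m + n + 1 + n ≡ m + n + (1 + n)
  regroup = solve-∀
  triple : ∀ m n → m + n + (n + n) ≡ m + 3 * n
  triple = solve-∀

module Clusters (G : Graph) (R : ℕ) where

  open Distance G

  record Cluster : Set where
    constructor cluster
    field
      centre : VPair (n G)
      radius : ℕ
      edges  : List (VPair (n G))
  open Cluster public

  _≟ᶜ_ : (c c′ : Cluster) → Dec (c ≡ c′)
  cluster e ρ E ≟ᶜ cluster e′ ρ′ E′ =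
    Dec.map′ (λ { (refl , refl , refl) → refl }) (λ { refl → refl , refl , refl })
             ((e ≟ᵖ e′) ×-dec (ρ ≟ℕ ρ′) ×-dec ≡-dec _≟ᵖ_ E E′)

  grow : Cluster → ℕ → VPair (n G) → Cluster
  grow c ρ x = cluster (centre c) ρ (x ∷ edges c)

  Touches : Cluster → V → Set
  Touches c w = ∃ λ y → y ∈ edges c × Ends y w

  ∈E⇒touches : ∀ {c u v w} → (u , v) ∈E edges c → Ends (u , v) w → Touches c w
  ∈E⇒touches (inj₁ uv∈) ends = _ , uv∈ , ends
  ∈E⇒touches (inj₂ vu∈) ends = _ , vu∈ , Sum.swap ends

  Far : ℕ → Cluster → Cluster → Set
  Far d c c′ = ∀ {w w′} → Touches c w → Touches c′ w′ → reach G d w w′ ≢ true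

  Far-sym : ∀ {d c c′} → Far d c c′ → Far d c′ c
  Far-sym {d} far t t′ ww′ = far t′ t (reach-sym d ww′)

  Far-mono : ∀ {d d′ c c′} → d′ ≤ d → Far d c c′ → Far d′ c c′
  Far-mono d′≤d far t t′ ww′ = far t t′ (reach-mono d′≤d ww′)

  record Clustering (d : ℕ) (M : List (VPair (n G))) (Cs : List Cluster) : Set where
    field
      covered   : ∀ {u v} → (u , v) ∈E M → ∃ λ c → c ∈ Cs × (u , v) ∈E edges c
      claimed   : ∀ {c} → c ∈ Cs → edges c ⊆E M
      local     : ∀ {c} → c ∈ Cs → ∀ {y} → y ∈ edges c → IsEdge (ball G (centre c) (radius c)) y
      bounded   : ∀ {c} → c ∈ Cs → radius c + d ≤ R
      separated : ∀ {c c′} → c ∈ Cs → c′ ∈ Cs → c ≡ c′ ⊎ Far d c c′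

  module _ {d M Cs} (C : Clustering d M Cs) where

    open Clustering C

    touching⇒≡ : ∀ {c c′ w} → c ∈ Cs → c′ ∈ Cs → Touches c w → Touches c′ w → c ≡ c′
    touching⇒≡ {w = w} c∈ c′∈ t t′ with separated c∈ c′∈
    ... | inj₁ c≡c′ = c≡c′
    ... | inj₂ far  = ⊥-elim (far t t′ (reach-refl d w))

    inBall : ∀ {c u v} → c ∈ Cs → (u , v) ∈E edges c → IsEdge (ball G (centre c) R) (u , v)
    inBall {c} {u} {v} c∈ uv∈ = ballEdge-mono (centre c) (u , v) radius≤R (oriented uv∈)
      where
      radius≤R : radius c ≤ R
      radius≤R = ≤-trans (m≤m+n (radius c) d) (bounded c∈)
      oriented : (u , v) ∈E edges c → IsEdge (ball G (centre c) (radius c)) (u , v)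
      oriented (inj₁ uv∈) = local c∈ uv∈
      oriented (inj₂ vu∈) = trans (ballAdj-sym G (centre c) (radius c) u v) (local c∈ vu∈)

  -- A connected winning set cannot straddle two clusters, as clusters share no vertex.
  module _ (H : Graph) (H-connected : Connected H) where

    private
      module DistanceH = Distance H

    won⇒clusterWon : ∀ {d M Cs} → Clustering d M Cs → Won H G M →
      ∃ λ c → c ∈ Cs × Won H (ball G (centre c) R) (edges c)
    won⇒clusterWon {d} {M} {Cs} C w with won⇒embeds H G w
    ... | (φ , φ-inj , claimed) , noIsolated =
      c₀ , c₀∈ , embeds⇒won H (ball G (centre c₀) R) (φ , φ-inj , inBall′) noIsolated
      where
      open Clustering C using (covered)

      a₀ b₀ : Fin (n H)
      a₀ = proj₁ H-connected
      b₀ = proj₁ (noIsolated a₀)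

      home : ∃ λ c → c ∈ Cs × (φ a₀ , φ b₀) ∈E edges c
      home = covered (proj₂ (claimed a₀ b₀ (proj₂ (noIsolated a₀))))

      c₀ : Cluster
      c₀ = proj₁ home

      c₀∈ : c₀ ∈ Cs
      c₀∈ = proj₁ (proj₂ home)

      Anchored : Fin (n H) → Set
      Anchored a = Touches c₀ (φ a)

      anchored-edge : ∀ {a b} → Anchored a → adj H a b ≡ true → (φ a , φ b) ∈E edges c₀
      anchored-edge {a} {b} t ab with covered (proj₂ (claimed a b ab))
      ... | c , c∈ , ab∈ with touching⇒≡ C c∈ c₀∈ (∈E⇒touches {c} ab∈ (inj₁ refl)) t
      ...   | refl = ab∈

      anchored-within : ∀ r a → reach H r a₀ a ≡ true → Anchored a
      anchored-within zero a a₀a with DistanceH.reach-zero⁻ a₀a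
      ... | refl = ∈E⇒touches {c₀} (proj₂ (proj₂ home)) (inj₁ refl)
      anchored-within (suc r) a a₀a with DistanceH.reach-suc⁻ r a₀a
      ... | inj₁ a₀a′ = anchored-within r a a₀a′
      ... | inj₂ (x , a₀x , xa) = ∈E⇒touches {c₀} (anchored-edge (anchored-within r x a₀x) xa) (inj₂ refl)

      anchored : ∀ a → Anchored a
      anchored a = anchored-within (proj₁ (proj₂ H-connected a₀ a)) a (proj₂ (proj₂ H-connected a₀ a))

      inBall′ : ∀ a b → adj H a b ≡ true →
        IsEdge (ball G (centre c₀) R) (φ a , φ b) × (φ a , φ b) ∈E edges c₀
      inBall′ a b ab = inBall C c₀∈ ab∈ , ab∈
        where
        ab∈ : (φ a , φ b) ∈E edges c₀
        ab∈ = anchored-edge (anchored a) ab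

  -- c′ receives Maker's new edge x and swallows every old cluster not kept in `others`.
  extend : ∀ {J M Cs x} → Clustering (3 * J) M Cs → (c′ : Cluster) (others : List Cluster) →
    (∀ {c} → c ∈ others → c ∈ Cs) →
    (∀ {c} → c ∈ Cs → c ∈ others ⊎ edges c ⊆ edges c′) →
    x ∈ edges c′ → edges c′ ⊆E (x ∷ M) →
    (∀ {y} → y ∈ edges c′ → IsEdge (ball G (centre c′) (radius c′)) y) →
    radius c′ + J ≤ R →
    (∀ {c} → c ∈ others → Far J c′ c) →
    Clustering J (x ∷ M) (c′ ∷ others)
  extend {J} {M} {Cs} {x} C c′ others others⊆ replaced x∈ c′⊆ c′-local c′-bounded c′-far = record
    { covered   = covered′
    ; claimed   = λ { (here refl) → c′⊆ ; (there c∈) → ∈E-there ∘ claimed (others⊆ c∈) }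
    ; local     = λ { (here refl) → c′-local ; (there c∈) → local (others⊆ c∈) }
    ; bounded   = bounded′
    ; separated = separated′
    }
    where
    open Clustering C
    covered′ : ∀ {u v} → (u , v) ∈E (x ∷ M) → ∃ λ c → c ∈ (c′ ∷ others) × (u , v) ∈E edges c
    covered′ uv∈ with ∈E-∷⁻ uv∈
    ... | inj₁ uv≡x = c′ , here refl , ∈E-⊆ (λ { (here refl) → x∈ }) uv≡x
    ... | inj₂ uv∈M with covered uv∈M
    ...   | c , c∈ , uv∈c with replaced c∈
    ...     | inj₁ c∈others = c , there c∈others , uv∈c
    ...     | inj₂ c⊆c′     = c′ , here refl , ∈E-⊆ c⊆c′ uv∈c
    bounded′ : ∀ {c} → c ∈ (c′ ∷ others) → radius c + J ≤ R
    bounded′ (here refl) = c′-bounded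
    bounded′ {c} (there c∈) = ≤-trans (+-monoʳ-≤ (radius c) (n≤3*n J)) (bounded (others⊆ c∈))
    separated′ : ∀ {c₁ c₂} → c₁ ∈ (c′ ∷ others) → c₂ ∈ (c′ ∷ others) → c₁ ≡ c₂ ⊎ Far J c₁ c₂
    separated′ (here refl) (here refl) = inj₁ refl
    separated′ (here refl) (there c₂∈) = inj₂ (c′-far c₂∈)
    separated′ {c₁} (there c₁∈) (here refl) = inj₂ (Far-sym {J} {c′} {c₁} (c′-far c₁∈))
    separated′ {c₁} {c₂} (there c₁∈) (there c₂∈) =
      Sum.map₂ (Far-mono {3 * J} {J} {c₁} {c₂} (n≤3*n J)) (separated (others⊆ c₁∈) (others⊆ c₂∈))

module BreakerStrategy (H : Graph) (H-connected : Connected H) (G : Graph) (k : ℕ)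
  (noLocalWin : ∀ e → IsEdge G e → ¬ MakerWinsIn H (ball G e (3 ^ k)) k) where

  open Distance G
  open Clusters G (3 ^ k)

  R : ℕ
  R = 3 ^ k

  Pair : Set
  Pair = VPair (n G)

  module Local (e : Pair) = Game H (ball G e R)

  -- In the local game of a cluster, every edge claimed outside it, by either player,
  -- counts as Breaker's.
  record Invariant (j : ℕ) (M B : List Pair) (Cs : List Cluster) : Set where
    field
      j≤k        : j ≤ k
      clustering : Clustering (3 ^ j) M Cs
      lost       : ∀ {c} → c ∈ Cs → ¬ MakerToMove H (ball G (centre c) R) j (edges c) (B ++ M)

  invariant⇒¬won : ∀ {j M B Cs} → Invariant j M B Cs → ¬ Won H G M
  invariant⇒¬won {j} I w with won⇒clusterWon H H-connected (Invariant.clustering I) w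
  ... | c , c∈ , wc = Invariant.lost I c∈ (Local.won⇒makerToMove (centre c) j wc)

  record Absorbed (j : ℕ) (M B : List Pair) (x : Pair) : Set where
    field
      j<k          : suc j ≤ k
      home         : Cluster
      radius′      : ℕ
      others       : List Cluster
      clustering′  : Clustering (3 ^ j) (x ∷ M) (grow home radius′ x ∷ others)
      homeLost     : ¬ MakerToMove H (ball G (centre home) R) (suc j) (edges home) (B ++ M)
      x-free       : Unclaimed (ball G (centre home) R) (edges home) (B ++ M) x
      othersLost   : ∀ {c} → c ∈ others →
                       ¬ MakerToMove H (ball G (centre c) R) (suc j) (edges c) (B ++ M)

  unclaimed⇒∉++ : ∀ {M B} x → Unclaimed G M B x → ¬ (x ∈E (B ++ M))
  unclaimed⇒∉++ {M} {B} (u , v) (_ , ∉M , ∉B) uv∈ = [ ∉B , ∉M ]′ (∈E-++⁻ B uv∈)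

  Linked : ℕ → Pair → Pair → Set
  Linked d x y = ∃ λ p → ∃ λ w → Ends x p × Ends y w × reach G d p w ≡ true

  linked? : ∀ d x y → Dec (Linked d x y)
  linked? d x y = any? λ p → any? λ w → ends? x p ×-dec ends? y w ×-dec (reach G d p w Bool.≟ true)

  -- x is within 3ʲ of the cluster c, which is 3ʲ⁺¹-far from all others: c absorbs x.
  joinCluster : ∀ {j M B Cs x c y} → Invariant (suc j) M B Cs → Unclaimed G M B x →
    c ∈ Cs → y ∈ edges c → Linked (3 ^ j) x y → Absorbed j M B x
  joinCluster {j} {M} {B} {Cs} {x} {c} {y} I ux c∈ y∈ (p , w , x∋p , y∋w , pw) = record
    { j<k         = j≤k
    ; home        = c
    ; radius′     = ρ′
    ; others      = others
    ; clustering′ = extend clustering c′ others others⊆ replaced (here refl) (∷⁺-⊆E (claimed c∈))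
                      local′ bounded′ far′
    ; homeLost    = lost c∈
    ; x-free      = ballEdge-mono (centre c) x (≤-trans (m≤m+n ρ′ J) bounded′) x-local
                  , proj₁ (proj₂ ux) ∘ claimed c∈
                  , unclaimed⇒∉++ x ux
    ; othersLost  = lost ∘ others⊆
    }
    where
    open Invariant I
    open Clustering clustering

    J ρ′ : ℕ
    J  = 3 ^ j
    ρ′ = radius c + J + 1

    c′ : Cluster
    c′ = grow c ρ′ x

    other? : ∀ d → Dec (d ≢ c)
    other? d = ¬? (d ≟ᶜ c)

    others : List Cluster
    others = filter other? Cs

    others⊆ : ∀ {d} → d ∈ others → d ∈ Cs
    others⊆ d∈ = proj₁ (∈-filter⁻ other? {xs = Cs} d∈)

    replaced : ∀ {d} → d ∈ Cs → d ∈ others ⊎ edges d ⊆ edges c′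
    replaced {d} d∈ with d ≟ᶜ c
    ... | yes refl = inj₂ there
    ... | no d≢c   = inj₁ (∈-filter⁺ other? d∈ d≢c)

    x-local : IsEdge (ball G (centre c) ρ′) x
    x-local = ballEdge⁺ (centre c) ρ′ x (proj₁ ux) λ x∋q →
      nearBoth-trans (centre c) (radius c + J) 1
        (nearBoth-trans (centre c) (radius c) J (ballEdge-ends (centre c) (radius c) y (local c∈ y∈) y∋w)
                        (reach-sym J pw))
        (edge-ends⇒reach x (proj₁ ux) x∋p x∋q)

    local′ : ∀ {y′} → y′ ∈ edges c′ → IsEdge (ball G (centre c) ρ′) y′
    local′ (here refl) = x-local
    local′ (there y′∈) =
      ballEdge-mono (centre c) _ (≤-trans (m≤m+n (radius c) J) (m≤m+n (radius c + J) 1)) (local c∈ y′∈)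

    bounded′ : ρ′ + J ≤ R
    bounded′ = ≤-trans (m+n+1+n≤m+3*n (radius c) (m^n>0 3 j)) (bounded c∈)

    c-far : ∀ {d} → d ∈ others → Far (3 * J) c d
    c-far {d} d∈ with separated c∈ (others⊆ d∈)
    ... | inj₁ refl  = ⊥-elim (proj₂ (∈-filter⁻ other? {xs = Cs} d∈) refl)
    ... | inj₂ far-d = far-d

    far′ : ∀ {d} → d ∈ others → Far J c′ d
    far′ d∈ (_ , here refl , x∋q) t qq′ = c-far d∈ (y , y∈ , y∋w) t
      (reach-mono (m+n+1+n≤m+3*n 0 (m^n>0 3 j))
        (reach-trans (J + 1) J
          (reach-trans J 1 (reach-sym J pw) (edge-ends⇒reach x (proj₁ ux) x∋p x∋q)) qq′))
    far′ d∈ (y′ , there y′∈ , y′∋q) t qq′ = c-far d∈ (y′ , y′∈ , y′∋q) t (reach-mono (n≤3*n J) qq′)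

  newCluster : ∀ {j M B Cs x} → Invariant (suc j) M B Cs → Unclaimed G M B x →
    (∀ {c y} → c ∈ Cs → y ∈ edges c → ¬ Linked (3 ^ j) x y) → Absorbed j M B x
  newCluster {j} {M} {B} {Cs} {x} I ux unlinked = record
    { j<k         = j≤k
    ; home        = cluster x 1 []
    ; radius′     = 1
    ; others      = Cs
    ; clustering′ = extend clustering (cluster x 1 (x ∷ [])) Cs (λ c∈ → c∈) inj₁ (here refl) (∷⁺-⊆E ∉[])
                      (λ { (here refl) → x-local }) bounded′ far′
    ; homeLost    = λ w → noLocalWin x (proj₁ ux)
                      (Local.makerToMove-mono x j≤k (Local.makerToMove-resp-⊇ x (suc j) ∉[] w))
    ; x-free      = ballEdge-mono x x (≤-trans (m≤m+n 1 J) bounded′) x-local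
                  , (λ { (inj₁ ()) ; (inj₂ ()) })
                  , unclaimed⇒∉++ x ux
    ; othersLost  = lost
    }
    where
    open Invariant I

    J : ℕ
    J = 3 ^ j

    ∉[] : ∀ {L : List Pair} → [] ⊆E L
    ∉[] (inj₁ ())
    ∉[] (inj₂ ())

    x-local : IsEdge (ball G x 1) x
    x-local = ballEdge⁺ x 1 x (proj₁ ux) (edge-ends⇒nearBoth x (proj₁ ux))

    bounded′ : 1 + J ≤ R
    bounded′ = ≤-trans (1+n≤3*n (m^n>0 3 j)) (^-monoʳ-≤ 3 j≤k)

    far′ : ∀ {c} → c ∈ Cs → Far J (cluster x 1 (x ∷ [])) c
    far′ c∈ (_ , here refl , x∋p) (y , y∈ , y∋w) pw = unlinked c∈ y∈ (_ , _ , x∋p , y∋w , pw)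

  absorb : ∀ {j M B Cs x} → Invariant (suc j) M B Cs → Unclaimed G M B x → Absorbed j M B x
  absorb {j} {Cs = Cs} {x} I ux with Any.any? (λ c → Any.any? (linked? (3 ^ j) x) (edges c)) Cs
  ... | yes near with find near
  ...   | c , c∈ , near-c with find near-c
  ...     | y , y∈ , xy = joinCluster I ux c∈ y∈ xy
  absorb I ux | no far = newCluster I ux λ c∈ y∈ xy → far (lose c∈ (lose y∈ xy))

  -- Breaker answers x inside the ball of its cluster; if that ball is full, anywhere.
  module _ {j M B x} (breakerHolds : ∀ {M B Cs} → Invariant j M B Cs → ¬ MakerToMove H G j M B)
           (A : Absorbed j M B x) where

    open Absorbed A

    module Home = Local (centre home)

    Cs′ : List Cluster
    Cs′ = grow home radius′ x ∷ others

    B++M⊆ : B ++ M ⊆ B ++ (x ∷ M)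
    B++M⊆ = ++⁺ʳ B (xs⊆x∷xs M x)

    othersStillLost : ∀ b {c} → c ∈ others →
      ¬ MakerToMove H (ball G (centre c) R) j (edges c) ((b ∷ B) ++ (x ∷ M))
    othersStillLost b {c} c∈ = othersLost c∈ ∘ Local.makerToMove-mono (centre c) (n≤1+n j)
                                 ∘ Local.makerToMove-resp-⊇ (centre c) j (∈E-⊆ (there ∘ B++M⊆))

    reinstate : ∀ b → ¬ MakerToMove H (ball G (centre home) R) j (x ∷ edges home) ((b ∷ B) ++ (x ∷ M)) →
      Invariant j (x ∷ M) (b ∷ B) Cs′
    reinstate b homeLost′ = record
      { j≤k        = ≤-trans (n≤1+n j) j<k
      ; clustering = clustering′
      ; lost       = λ { (here refl) → homeLost′ ; (there c∈) → othersStillLost b c∈ }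
      }

    unclaimed-globally : ∀ f → Unclaimed (ball G (centre home) R) (x ∷ edges home) (B ++ M) f →
      Unclaimed G (x ∷ M) B f
    unclaimed-globally (u , v) (edge , ∉x∷home , ∉B++M) =
      ∧-true⁻ˡ edge , ∉x∷M , ∉B++M ∘ ∈E-⊆ (xs⊆xs++ys B M)
      where
      ∉x∷M : ¬ ((u , v) ∈E (x ∷ M))
      ∉x∷M uv∈ with ∈E-∷⁻ uv∈
      ... | inj₁ uv≡x = ∉x∷home (∈E-⊆ (λ { (here refl) → here refl }) uv≡x)
      ... | inj₂ uv∈M = ∉B++M (∈E-⊆ (xs⊆ys++xs M B) uv∈M)

    respond : ¬ BreakerToMove H G j (x ∷ M) B
    respond bt with Home.¬breakerToMove⇒reply j (λ bt′ → homeLost (inj₂ (x , x-free , bt′))) | bt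
    ... | ¬won , _ | inj₁ w with won⇒clusterWon H H-connected clustering′ w
    ...   | _ , here refl , wc = ¬won wc
    ...   | c , there c∈ , wc = othersLost c∈ (Local.won⇒makerToMove (centre c) (suc j) wc)
    respond bt | ¬won , inj₁ stuck | inj₂ ((g , ug) , reply) =
      breakerHolds (reinstate g (Home.stuck⇒¬makerToMove j ¬won stuck
                                  ∘ Home.makerToMove-resp-⊇ j (∈E-⊆ (there ∘ B++M⊆))))
                   (reply g ug)
    respond bt | _ , inj₂ (f , uf , ¬won-after-f) | inj₂ (_ , reply) =
      breakerHolds (reinstate f (¬won-after-f ∘ Home.makerToMove-resp-⊇ j (∈E-⊆ (∷⁺ʳ f B++M⊆))))
                   (reply f (unclaimed-globally f uf))

  breakerHolds : ∀ j {M B Cs} → Invariant j M B Cs → ¬ MakerToMove H G j M B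
  breakerHolds zero    I w        = invariant⇒¬won I w
  breakerHolds (suc j) I (inj₁ w) = invariant⇒¬won I w
  breakerHolds (suc j) I (inj₂ (x , ux , bt)) = respond (breakerHolds j) (absorb I ux) bt

  initial : Invariant k [] [] []
  initial = record
    { j≤k        = ≤-refl
    ; clustering = record
      { covered   = λ { (inj₁ ()) ; (inj₂ ()) }
      ; claimed   = λ ()
      ; local     = λ ()
      ; bounded   = λ ()
      ; separated = λ ()
      }
    ; lost       = λ ()
    }

  ¬makerWinsIn : ¬ MakerWinsIn H G k
  ¬makerWinsIn = breakerHolds k initial

makerWinsIn⇒makerWinsIn-ball : ∀ H → Connected H → ∀ G k → MakerWinsIn H G k →
  Σ (VPair (n G)) λ e → IsEdge G e × MakerWinsIn H (ball G e (3 ^ k)) k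
makerWinsIn⇒makerWinsIn-ball H H-connected G k w
  with Game.∃-pair? H G _ (λ e → isEdge? G e ×-dec Game.makerToMove? H (ball G e (3 ^ k)) k [] [])
... | yes localWin = localWin
... | no ¬localWin = ⊥-elim (BreakerStrategy.¬makerWinsIn H H-connected G k
                               (λ e edge w′ → ¬localWin (e , edge , w′)) w)

theorem17 : (H : Graph) → Connected H → (G : Graph) → (k : ℕ) → 1 ≤ k →
    MakerWinsIn H G k ⇔ Σ (VPair (n G)) (λ e → IsEdge G e × MakerWinsIn H (ball G e (3 ^ k)) k)
theorem17 H H-connected G k _ = mk⇔
  (makerWinsIn⇒makerWinsIn-ball H H-connected G k)
  (λ (e , _ , w) → BallGame.makerWinsIn-ball⇒makerWinsIn H G e (3 ^ k) k w)
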